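{- For every positive integer $d$ and all nontrivial trees $T_1,\dots,T_d$ (each with at least two vertices), we have $$c_{2,2}(T_1\,\Box\,\cdots\,\Box\,T_d)\ge\lfloor d/2\rfloor.$$
   Context: All graphs are finite, undirected and reflexive. In the speed-$(2,2)$ Cops and Robbers game on a graph $G$, the cops first place themselves on vertices, then the robber places himself; play proceeds in rounds, each a cops' turn followed by a robber's turn. On the cops' turn each cop moves along a walk of length at most $2$ (possibly staying put); on the robber's turn he moves along a walk of length at most $2$ not passing through a cop-occupied vertex. The cops win if some cop occupies the robber's vertex; the robber wins if he evades forever. $c_{2,2}(G)$ is the minimum number of cops guaranteeing a win. $\Box$ denotes the Cartesian product of graphs. -}

module Defs where

open import Level using (0ℓ)
open import Data.Nat using (ℕ; zero; suc; _≤_)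
open import Data.Fin using (Fin; zero; suc; inject₁; fromℕ)
open import Data.Product using (Σ; ∃; ∃-syntax; _×_; _,_)
open import Data.Sum using (_⊎_)
open import Relation.Nullary using (¬_; Dec)
open import Relation.Binary.PropositionalEquality using (_≡_; _≢_)
open import Function.Bundles using (_↔_)
open import Function.Definitions using (Injective)

record Graph : Set₁ where
  field
    V     : Set
    Adj   : V → V → Set
    refl  : ∀ v → Adj v v
    sym   : ∀ {u v} → Adj u v → Adj v u
open Graph public

IsFinite : Graph → Set
IsFinite G = (Σ ℕ λ n → V G ↔ Fin n) × (∀ u v → Dec (Adj G u v))

data Walk (G : Graph) : V G → V G → Set where
  here : ∀ {v} → Walk G v v
  step : ∀ {u w v} → Adj G u w → Walk G w v → Walk G u v

Connected : Graph → Set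
Connected G = ∀ u v → Walk G u v

record Cycle (G : Graph) : Set where
  field
    m     : ℕ
    f     : Fin (suc (suc (suc m))) → V G
    inj   : Injective _≡_ _≡_ f
    links : ∀ (i : Fin (suc (suc m))) → Adj G (f (inject₁ i)) (f (suc i))
    close : Adj G (f (fromℕ (suc (suc m)))) (f zero)

Acyclic : Graph → Set
Acyclic G = ¬ Cycle G

IsTree : Graph → Set
IsTree G = IsFinite G × Connected G × Acyclic G

Nontrivial : Graph → Set
Nontrivial G = Σ (V G) λ u → Σ (V G) λ v → u ≢ v

_□_ : Graph → Graph → Graph
G □ H = record
  { V    = V G × V H
  ; Adj  = λ { (a , b) (a' , b') → (Adj G a a' × b ≡ b') ⊎ (a ≡ a' × Adj H b b') }
  ; refl = λ { (a , b) → Data.Sum.inj₁ (Graph.refl G a , Relation.Binary.PropositionalEquality.refl) }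
  ; sym  = λ { (Data.Sum.inj₁ (e , Relation.Binary.PropositionalEquality.refl)) → Data.Sum.inj₁ (Graph.sym G e , Relation.Binary.PropositionalEquality.refl)
             ; (Data.Sum.inj₂ (Relation.Binary.PropositionalEquality.refl , e)) → Data.Sum.inj₂ (Relation.Binary.PropositionalEquality.refl , Graph.sym H e) }
  }

-- T 0 □ T 1 □ ⋯ □ T m   (d = m+1 factors)
prod : ∀ m → (Fin (suc m) → Graph) → Graph
prod zero    T = T zero
prod (suc m) T = T zero □ prod m (λ i → T (suc i))

module Game (G : Graph) (k : ℕ) where

  Config : Set
  Config = Fin k → V G

  -- walk of length at most 2 (graph is reflexive)
  Reach2 : V G → V G → Set
  Reach2 u v = Σ (V G) λ w → Adj G u w × Adj G w v

  Occupied : Config → V G → Set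
  Occupied C x = Σ (Fin k) λ i → C i ≡ x

  CopMove : Config → Config → Set
  CopMove C C' = ∀ i → Reach2 (C i) (C' i)

  RobMove : Config → V G → V G → Set
  RobMove C r r' = Σ (V G) λ w → Adj G r w × Adj G w r'
                     × ¬ Occupied C w × ¬ Occupied C r'

  -- cops, to move from configuration C with robber at r, can force capture
  data CopsForce : Config → V G → Set where
    move : ∀ {C r} (C' : Config) → CopMove C C' →
           (Occupied C' r ⊎ (∀ r' → RobMove C' r r' → CopsForce C' r')) →
           CopsForce C r

  CopsWin : Set
  CopsWin = Σ Config λ C₀ → ∀ r → Occupied C₀ r ⊎ CopsForce C₀ r

-- c_{2,2}(G) ≥ b  (c_{2,2} is the least k for which k cops win)
c22≥ : Graph → ℕ → Set
c22≥ G b = ∀ k → Game.CopsWin G k → b ≤ k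

-- Fix an edge aᵢbᵢ in every factor Tᵢ.  Recording, for each coordinate, whether a vertex is bᵢ
-- maps T₁ □ ⋯ □ T_d onto the hypercube Q_d without increasing distances, and the vertices all of
-- whose coordinates are aᵢ or bᵢ form a copy of Q_d on which this map is the identity.  The robber
-- stays on that copy and keeps Hamming distance at least 3 from the image of every cop.  After the
-- cops' move each image is still at distance at least 1, and when d ≥ 2k + 2 a counting argument
-- finds one or two coordinates whose toggling restores distance 3 from all k cops at once.
module Submission where

open import Defs hiding (refl; sym)
open import Data.Nat using (ℕ; suc; _/_)
open import Data.Fin using (Fin)

open import Algebra.Bundles using (CommutativeRing)
import Algebra.Properties.CommutativeSemigroup as CommutativeSemigroupProperties
open import Data.Bool using (Bool; true; false; not; _xor_; if_then_else_)
open import Data.Bool.Properties using (xor-same; xor-identityʳ; xor-inverseʳ; xor-∧-commutativeRing)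
open import Data.Fin using (zero; suc)
open import Data.Fin.Properties using (¬∀⟶∃¬) renaming (_≟_ to _≟ᶠ_)
open import Data.Maybe using (Maybe; just; nothing)
open import Data.Nat using (zero; _+_; _*_; _≤_; _<_; _≤?_; _<?_; _≤ᵇ_; z≤n; s≤s; z<s)
open import Data.Nat.DivMod using (m/n*n≤m)
open import Data.Nat.Properties
open import Data.Nat.Tactic.RingSolver using (solve-∀)
open import Data.Product using (∃; ∃₂; _×_; _,_; map₂)
open import Data.Sum using (inj₁; inj₂; [_,_]′)
open import Data.Vec.Functional using (Vector; updateAt; _∷_)
open import Function using (_∘_)
open import Function.Properties.Inverse using (Inverse⇒Injection)
open import Relation.Binary.Definitions using (DecidableEquality)
open import Relation.Binary.PropositionalEquality
  using (_≡_; _≢_; _≗_; refl; sym; trans; cong; cong₂; module ≡-Reasoning)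
open import Relation.Nullary using (¬_; contradiction; does; yes; no)
open import Relation.Nullary.Decidable using (via-injection; dec-true; dec-false)

open import Algebra.Properties.Semiring.Sum +-*-semiring
  using (sum; sum-syntax; sum-cong-≗; ∑-comm; ∑-distrib-+; *-distribˡ-sum; sum-replicate-zero)
open CommutativeSemigroupProperties +-commutativeSemigroup
  using () renaming (x∙yz≈y∙xz to +-leftComm)
open CommutativeSemigroupProperties (CommutativeRing.+-commutativeSemigroup xor-∧-commutativeRing)
  using () renaming (x∙yz≈y∙xz to xor-leftComm)

private
  variable
    d k n : ℕ

∑-mono-≤ : {f g : Vector ℕ n} → (∀ i → f i ≤ g i) → sum f ≤ sum g
∑-mono-≤ {zero}  f≤g = z≤n
∑-mono-≤ {suc n} f≤g = +-mono-≤ (f≤g zero) (∑-mono-≤ (f≤g ∘ suc))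

∑-const : ∀ n a → ∑[ i < n ] a ≡ n * a
∑-const zero    a = refl
∑-const (suc n) a = cong (a +_) (∑-const n a)

∑f≤n*a : ∀ {f : Vector ℕ n} {a} → (∀ i → f i ≤ a) → sum f ≤ n * a
∑f≤n*a {n} {a = a} f≤a = ≤-trans (∑-mono-≤ f≤a) (≤-reflexive (∑-const n a))

n*a≤∑f : ∀ {f : Vector ℕ n} {a} → (∀ i → a ≤ f i) → n * a ≤ sum f
n*a≤∑f {n} {a = a} a≤f = ≤-trans (≤-reflexive (sym (∑-const n a))) (∑-mono-≤ a≤f)

fi≤∑f : (f : Vector ℕ n) (i : Fin n) → f i ≤ sum f
fi≤∑f f zero    = m≤m+n _ _
fi≤∑f f (suc i) = ≤-trans (fi≤∑f (f ∘ suc) i) (m≤n+m _ _)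

∑f<n*[1+t]⇒∃fi≤t : ∀ (f : Vector ℕ n) t → sum f < n * suc t → ∃ λ i → f i ≤ t
∑f<n*[1+t]⇒∃fi≤t {n} f t ∑f<n*[1+t] =
  map₂ ≮⇒≥ (¬∀⟶∃¬ n (λ i → t < f i) (λ i → t <? f i) (<⇒≱ ∑f<n*[1+t] ∘ n*a≤∑f))

Cube : ℕ → Set
Cube d = Fin d → Bool

∅ : Cube d
∅ _ = false

-- Toggling coordinate i of x is written ⁅ i ⁆ ⊕ x rather than x ⊕ ⁅ i ⁆: since _xor_ computes on
-- its first argument, the other coordinates of ⁅ i ⁆ ⊕ x are then definitionally those of x, which
-- □-cubeRetract relies on.
⁅_⁆ : Fin d → Cube d
⁅ i ⁆ = updateAt ∅ i not

infixr 6 _⊕_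
_⊕_ : Cube d → Cube d → Cube d
(p ⊕ q) j = p j xor q j

bit : Bool → ℕ
bit false = 0
bit true  = 1

∣_∣ : Cube d → ℕ
∣ s ∣ = sum (bit ∘ s)

hamming : Cube d → Cube d → ℕ
hamming p q = ∣ p ⊕ q ∣

bit≤1 : ∀ b → bit b ≤ 1
bit≤1 false = z≤n
bit≤1 true  = ≤-refl

∣∅∣ : ∣ ∅ {d} ∣ ≡ 0
∣∅∣ {d} = sum-replicate-zero d

∣s∣≤0⇒s≗∅ : (s : Cube d) → ∣ s ∣ ≤ 0 → s ≗ ∅
∣s∣≤0⇒s≗∅ s ∣s∣≤0 i = bit≤0 (≤-trans (fi≤∑f (bit ∘ s) i) ∣s∣≤0)
  where
  bit≤0 : ∀ {b} → bit b ≤ 0 → b ≡ false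
  bit≤0 {false} _ = refl

∣⁅i⁆∣ : ∀ (i : Fin d) → ∣ ⁅ i ⁆ ∣ ≡ 1
∣⁅i⁆∣ {suc d} zero    = cong suc (∣∅∣ {d})
∣⁅i⁆∣         (suc i) = ∣⁅i⁆∣ i

∣⁅i⁆⊕s∣ : ∀ i (s : Cube d) → bit (s i) + ∣ ⁅ i ⁆ ⊕ s ∣ ≡ bit (not (s i)) + ∣ s ∣
∣⁅i⁆⊕s∣ zero    s = +-leftComm (bit (s zero)) (bit (not (s zero))) ∣ s ∘ suc ∣
∣⁅i⁆⊕s∣ (suc i) s = begin
  bit (s (suc i)) + (bit (s zero) + ∣ ⁅ i ⁆ ⊕ s ∘ suc ∣)  ≡⟨ +-leftComm (bit (s (suc i))) (bit (s zero)) _ ⟩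
  bit (s zero) + (bit (s (suc i)) + ∣ ⁅ i ⁆ ⊕ s ∘ suc ∣)  ≡⟨ cong (bit (s zero) +_) (∣⁅i⁆⊕s∣ i (s ∘ suc)) ⟩
  bit (s zero) + (bit (not (s (suc i))) + ∣ s ∘ suc ∣)    ≡⟨ +-leftComm (bit (s zero)) (bit (not (s (suc i)))) _ ⟩
  bit (not (s (suc i))) + (bit (s zero) + ∣ s ∘ suc ∣)    ∎
  where open ≡-Reasoning

∣⁅i⁆⊕s∣-true : ∀ i (s : Cube d) → s i ≡ true → suc ∣ ⁅ i ⁆ ⊕ s ∣ ≡ ∣ s ∣
∣⁅i⁆⊕s∣-true i s si with ∣⁅i⁆⊕s∣ i s
... | eq rewrite si = eq

∣⁅i⁆⊕s∣-false : ∀ i (s : Cube d) → s i ≡ false → ∣ ⁅ i ⁆ ⊕ s ∣ ≡ suc ∣ s ∣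
∣⁅i⁆⊕s∣-false i s si with ∣⁅i⁆⊕s∣ i s
... | eq rewrite si = eq

∣⁅i⁆⊕s∣-≥ : ∀ i (s : Cube d) → suc n ≤ ∣ s ∣ → n ≤ ∣ ⁅ i ⁆ ⊕ s ∣
∣⁅i⁆⊕s∣-≥ i s 1+n≤∣s∣ with s i in si
... | true  = ≤-pred (≤-trans 1+n≤∣s∣ (≤-reflexive (sym (∣⁅i⁆⊕s∣-true i s si))))
... | false = ≤-trans (n≤1+n _) (≤-trans 1+n≤∣s∣ (≤-trans (n≤1+n _) (≤-reflexive (sym (∣⁅i⁆⊕s∣-false i s si)))))

bit-xor-triangle : ∀ a b c → bit (a xor c) ≤ bit (a xor b) + bit (b xor c)
bit-xor-triangle false false c     = ≤-refl
bit-xor-triangle true  true  c     = ≤-refl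
bit-xor-triangle false true  false = z≤n
bit-xor-triangle false true  true  = s≤s z≤n
bit-xor-triangle true  false false = s≤s z≤n
bit-xor-triangle true  false true  = z≤n

hamming-triangle : ∀ (p q r : Cube d) → hamming p r ≤ hamming p q + hamming q r
hamming-triangle p q r = begin
  hamming p r                                        ≤⟨ ∑-mono-≤ (λ j → bit-xor-triangle (p j) (q j) (r j)) ⟩
  ∑[ j < _ ] (bit (p j xor q j) + bit (q j xor r j))  ≡⟨ ∑-distrib-+ (bit ∘ (p ⊕ q)) (bit ∘ (q ⊕ r)) ⟩
  hamming p q + hamming q r                          ∎
  where open ≤-Reasoning

hamming-≗ : {p q : Cube d} → p ≗ q → hamming p q ≡ 0
hamming-≗ {d} {p} p≗q =
  trans (sum-cong-≗ λ j → cong bit (trans (cong (p j xor_) (sym (p≗q j))) (xor-same (p j)))) (∣∅∣ {d})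

hamming-⊕ˡ : ∀ (x e : Cube d) → hamming x (e ⊕ x) ≡ ∣ e ∣
hamming-⊕ˡ x e = sum-cong-≗ λ j → cong bit (begin
  x j xor (e j xor x j)  ≡⟨ xor-leftComm (x j) (e j) (x j) ⟩
  e j xor (x j xor x j)  ≡⟨ cong (e j xor_) (xor-same (x j)) ⟩
  e j xor false          ≡⟨ xor-identityʳ (e j) ⟩
  e j                    ∎)
  where open ≡-Reasoning

uncovered : ∀ {r} (F : Fin r → Cube d) → ∑[ c < r ] ∣ F c ∣ < d → ∃ λ j → ∀ c → F c j ≡ false
uncovered {d} {r} F ∑∣F∣<d =
  map₂ (λ {j} → ∣s∣≤0⇒s≗∅ (λ c → F c j)) (∑f<n*[1+t]⇒∃fi≤t (λ j → ∑[ c < r ] bit (F c j)) 0 ∑∑F<d*1)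
  where
  open ≤-Reasoning
  ∑∑F<d*1 : ∑[ j < d ] ∑[ c < r ] bit (F c j) < d * 1
  ∑∑F<d*1 = begin-strict
    ∑[ j < d ] ∑[ c < r ] bit (F c j)  ≡⟨ ∑-comm (λ c j → bit (F c j)) ⟨
    ∑[ c < r ] ∣ F c ∣                  <⟨ ∑∣F∣<d ⟩
    d                                  ≡⟨ *-identityʳ d ⟨
    d * 1                              ∎

diagonal : k ≤ d → (p : Fin k → Cube d) → ∃ λ x → ∀ c → 1 ≤ hamming (p c) x
diagonal {zero}  _         p = ∅ , λ ()
diagonal {suc k} (s≤s k≤d) p with diagonal k≤d (λ c → p (suc c) ∘ suc)
... | x , far = not (p zero zero) ∷ x , λ
  { zero    → ≤-trans (≤-reflexive (cong bit (sym (xor-inverseʳ (p zero zero))))) (m≤m+n _ _)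
  ; (suc c) → ≤-trans (far c) (m≤n+m _ _)
  }

-- A cop whose difference from the robber has weight n charges loadFactor n to each coordinate of
-- that difference, at most 4 in total; hence for k cops and d ≥ 2k + 2 some coordinate carries
-- load at most 1.
loadFactor : ℕ → ℕ
loadFactor n = if n ≤ᵇ 2 then 2 else if n ≤ᵇ 4 then 1 else 0

loadFactor*n≤4 : ∀ n → loadFactor n * n ≤ 4
loadFactor*n≤4 0 = z≤n
loadFactor*n≤4 1 = s≤s (s≤s z≤n)
loadFactor*n≤4 2 = ≤-refl
loadFactor*n≤4 3 = s≤s (s≤s (s≤s z≤n))
loadFactor*n≤4 4 = ≤-refl
loadFactor*n≤4 (suc (suc (suc (suc (suc _))))) = z≤n

load : Cube d → Fin d → ℕ
load s i = loadFactor ∣ s ∣ * bit (s i)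

∑-load≤4 : (s : Cube d) → ∑[ i < d ] load s i ≤ 4
∑-load≤4 s = ≤-trans (≤-reflexive (sym (*-distribˡ-sum (loadFactor ∣ s ∣) (bit ∘ s)))) (loadFactor*n≤4 ∣ s ∣)

lightCoordinate : 2 + 2 * k ≤ d → (s : Fin k → Cube d) → ∃ λ i → ∑[ c < k ] load (s c) i ≤ 1
lightCoordinate {k} {d} 2+2k≤d s = ∑f<n*[1+t]⇒∃fi≤t (λ i → ∑[ c < k ] load (s c) i) 1 (begin-strict
  ∑[ i < d ] ∑[ c < k ] load (s c) i  ≡⟨ ∑-comm (λ c i → load (s c) i) ⟨
  ∑[ c < k ] ∑[ i < d ] load (s c) i  ≤⟨ ∑f≤n*a (λ c → ∑-load≤4 (s c)) ⟩
  k * 4                               <⟨ m<n+m (k * 4) z<s ⟩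
  4 + k * 4                           ≡⟨ 4+k*4≡[2+2k]*2 k ⟩
  (2 + 2 * k) * 2                     ≤⟨ *-monoˡ-≤ 2 2+2k≤d ⟩
  d * 2                               ∎)
  where
  open ≤-Reasoning
  4+k*4≡[2+2k]*2 : ∀ k → 4 + k * 4 ≡ (2 + 2 * k) * 2
  4+k*4≡[2+2k]*2 = solve-∀

-- Let s be the difference between a cop and the robber, n = ∣ s ∣ and b = s i.  After the robber
-- toggles i, stuck s i says that stopping there leaves the cop within distance 2, and blocked s i
-- contains every j ≠ i whose toggling next could do so.  The case n ≤ 2, b = true is ruled out by
-- load s i ≤ 1, so the value chosen for it is arbitrary.
blockedFor : ℕ → Bool → Cube d → Fin d → Cube d
blockedFor n false s i = if n ≤ᵇ 2 then s else ∅
blockedFor n true  s i = if n ≤ᵇ 4 then ⁅ i ⁆ ⊕ s else ∅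

stuckFor : ℕ → Bool → Bool
stuckFor n false = n ≤ᵇ 1
stuckFor n true  = n ≤ᵇ 3

blocked : Cube d → Fin d → Cube d
blocked s i = blockedFor ∣ s ∣ (s i) s i

stuck : Cube d → Fin d → Bool
stuck s i = stuckFor ∣ s ∣ (s i)

module _ (s : Cube d) (i : Fin d) where

  private
    ∣⁅i⁆⊕s∣-dec : ∣ s ∣ ≡ suc n → s i ≡ true → ∣ ⁅ i ⁆ ⊕ s ∣ ≡ n
    ∣⁅i⁆⊕s∣-dec ∣s∣≡1+n si = suc-injective (trans (∣⁅i⁆⊕s∣-true i s si) ∣s∣≡1+n)

    ∣⁅i⁆⊕s∣-inc : ∣ s ∣ ≡ n → s i ≡ false → ∣ ⁅ i ⁆ ⊕ s ∣ ≡ suc n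
    ∣⁅i⁆⊕s∣-inc ∣s∣≡n si = trans (∣⁅i⁆⊕s∣-false i s si) (cong suc ∣s∣≡n)

  unstuck⇒far : stuck s i ≡ false → 3 ≤ ∣ ⁅ i ⁆ ⊕ s ∣
  unstuck⇒far = go ∣ s ∣ (s i) refl refl
    where
    go : ∀ n b → ∣ s ∣ ≡ n → s i ≡ b → stuckFor n b ≡ false → 3 ≤ ∣ ⁅ i ⁆ ⊕ s ∣
    go (suc (suc n)) false ∣s∣≡n si _
      rewrite ∣⁅i⁆⊕s∣-inc ∣s∣≡n si = s≤s (s≤s (s≤s z≤n))
    go (suc (suc (suc (suc n)))) true ∣s∣≡n si _
      rewrite ∣⁅i⁆⊕s∣-dec ∣s∣≡n si = s≤s (s≤s (s≤s z≤n))
    go 0 false _ _ ()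
    go 1 false _ _ ()
    go 0 true  _ _ ()
    go 1 true  _ _ ()
    go 2 true  _ _ ()
    go 3 true  _ _ ()

  budget : 1 ≤ ∣ s ∣ → load s i ≤ 1 → ∣ blocked s i ∣ + bit (stuck s i) ≤ 2 + load s i
  budget = go ∣ s ∣ (s i) refl refl
    where
    go : ∀ n b → ∣ s ∣ ≡ n → s i ≡ b → 1 ≤ n → loadFactor n * bit b ≤ 1 →
         ∣ blockedFor n b s i ∣ + bit (stuckFor n b) ≤ 2 + loadFactor n * bit b
    go 1 false ∣s∣≡1 _  _ _ rewrite ∣s∣≡1 = ≤-refl
    go 2 false ∣s∣≡2 _  _ _ rewrite ∣s∣≡2 = ≤-refl
    go 3 false _     _  _ _ rewrite ∣∅∣ {d} = z≤n
    go 4 false _     _  _ _ rewrite ∣∅∣ {d} = z≤n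
    go 3 true  ∣s∣≡3 si _ _ rewrite ∣⁅i⁆⊕s∣-dec ∣s∣≡3 si = ≤-refl
    go 4 true  ∣s∣≡4 si _ _ rewrite ∣⁅i⁆⊕s∣-dec ∣s∣≡4 si = ≤-refl
    go (suc (suc (suc (suc (suc _))))) false _ _ _ _ rewrite ∣∅∣ {d} = z≤n
    go (suc (suc (suc (suc (suc _))))) true  _ _ _ _ rewrite ∣∅∣ {d} = z≤n
    go 0 _    _ _ () _
    go 1 true _ _ _  (s≤s ())
    go 2 true _ _ _  (s≤s ())

  unblocked⇒far : ∀ {j} → 1 ≤ ∣ s ∣ → load s i ≤ 1 → ⁅ i ⁆ j ≡ false → blocked s i j ≡ false →
                  3 ≤ ∣ ⁅ j ⁆ ⊕ ⁅ i ⁆ ⊕ s ∣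
  unblocked⇒far {j} = go ∣ s ∣ (s i) refl refl
    where
    go : ∀ n b → ∣ s ∣ ≡ n → s i ≡ b → 1 ≤ n → loadFactor n * bit b ≤ 1 → ⁅ i ⁆ j ≡ false →
         blockedFor n b s i j ≡ false → 3 ≤ ∣ ⁅ j ⁆ ⊕ ⁅ i ⁆ ⊕ s ∣
    go 1 false ∣s∣≡1 si _ _ ij sj
      rewrite ∣⁅i⁆⊕s∣-false j (⁅ i ⁆ ⊕ s) (cong₂ _xor_ ij sj) | ∣⁅i⁆⊕s∣-inc ∣s∣≡1 si = ≤-refl
    go 2 false ∣s∣≡2 si _ _ ij sj
      rewrite ∣⁅i⁆⊕s∣-false j (⁅ i ⁆ ⊕ s) (cong₂ _xor_ ij sj) | ∣⁅i⁆⊕s∣-inc ∣s∣≡2 si = s≤s (s≤s (s≤s z≤n))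
    go (suc (suc (suc n))) false ∣s∣≡3+n si _ _ _ _ = ∣⁅i⁆⊕s∣-≥ j (⁅ i ⁆ ⊕ s)
      (≤-trans (s≤s (s≤s (s≤s (s≤s z≤n)))) (≤-reflexive (sym (∣⁅i⁆⊕s∣-inc ∣s∣≡3+n si))))
    go 3 true ∣s∣≡3 si _ _ _ ⁅i⁆⊕s⟨j⟩
      rewrite ∣⁅i⁆⊕s∣-false j (⁅ i ⁆ ⊕ s) ⁅i⁆⊕s⟨j⟩ | ∣⁅i⁆⊕s∣-dec ∣s∣≡3 si = ≤-refl
    go 4 true ∣s∣≡4 si _ _ _ ⁅i⁆⊕s⟨j⟩
      rewrite ∣⁅i⁆⊕s∣-false j (⁅ i ⁆ ⊕ s) ⁅i⁆⊕s⟨j⟩ | ∣⁅i⁆⊕s∣-dec ∣s∣≡4 si = s≤s (s≤s (s≤s z≤n))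
    go (suc (suc (suc (suc (suc n))))) true ∣s∣≡5+n si _ _ _ _ = ∣⁅i⁆⊕s∣-≥ j (⁅ i ⁆ ⊕ s)
      (≤-trans (s≤s (s≤s (s≤s (s≤s z≤n)))) (≤-reflexive (sym (∣⁅i⁆⊕s∣-dec ∣s∣≡5+n si))))
    go 0 _    _ _ () _ _ _
    go 1 true _ _ _  (s≤s ()) _ _
    go 2 true _ _ _  (s≤s ()) _ _

stuckCops : (Fin k → Cube d) → Fin d → Cube k
stuckCops s i c = stuck (s c) i

noneStuck⇒far : (s : Fin k → Cube d) (i : Fin d) → ∣ stuckCops s i ∣ ≤ 0 → ∀ c → 3 ≤ ∣ ⁅ i ⁆ ⊕ s c ∣
noneStuck⇒far s i none c = unstuck⇒far (s c) i (∣s∣≤0⇒s≗∅ (stuckCops s i) none c)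

forbidden : (Fin k → Cube d) → Fin d → Fin (suc k) → Cube d
forbidden s i = ⁅ i ⁆ ∷ λ c → blocked (s c) i

someStuck⇒fewForbidden : 2 + 2 * k ≤ d → (s : Fin k → Cube d) → (∀ c → 1 ≤ ∣ s c ∣) →
                       ∀ {i} → ∑[ c < k ] load (s c) i ≤ 1 → 1 ≤ ∣ stuckCops s i ∣ →
                       ∑[ c < suc k ] ∣ forbidden s i c ∣ < d
someStuck⇒fewForbidden {k} {d} 2+2k≤d s nonzero {i} light 1≤#stuck = begin-strict
  ∣ ⁅ i ⁆ ∣ + ∑blocked  ≡⟨ cong (_+ ∑blocked) (∣⁅i⁆∣ i) ⟩
  1 + ∑blocked         ≤⟨ s≤s (+-cancelʳ-≤ 1 ∑blocked (k * 2) ∑blocked+1≤2k+1) ⟩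
  1 + k * 2            <⟨ ≤-trans (≤-reflexive (cong (2 +_) (*-comm k 2))) 2+2k≤d ⟩
  d                    ∎
  where
  open ≤-Reasoning
  ∑blocked : ℕ
  ∑blocked = ∑[ c < k ] ∣ blocked (s c) i ∣
  ∑blocked+1≤2k+1 : ∑blocked + 1 ≤ k * 2 + 1
  ∑blocked+1≤2k+1 = begin
    ∑blocked + 1                                            ≤⟨ +-monoʳ-≤ ∑blocked 1≤#stuck ⟩
    ∑blocked + ∣ stuckCops s i ∣                            ≡⟨ ∑-distrib-+ (λ c → ∣ blocked (s c) i ∣) (bit ∘ stuckCops s i) ⟨
    ∑[ c < k ] (∣ blocked (s c) i ∣ + bit (stuck (s c) i))  ≤⟨ ∑-mono-≤ (λ c → budget (s c) i (nonzero c) (light-at c)) ⟩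
    ∑[ c < k ] (2 + load (s c) i)                           ≡⟨ ∑-distrib-+ (λ _ → 2) (λ c → load (s c) i) ⟩
    ∑[ c < k ] 2 + ∑[ c < k ] load (s c) i                  ≤⟨ +-mono-≤ (≤-reflexive (∑-const k 2)) light ⟩
    k * 2 + 1                                               ∎
    where
    light-at : ∀ c → load (s c) i ≤ 1
    light-at c = ≤-trans (fi≤∑f (λ c → load (s c) i) c) light

hop : Maybe (Fin d) → Cube d
hop nothing  = ∅
hop (just i) = ⁅ i ⁆

∣hop∣≤1 : (o : Maybe (Fin d)) → ∣ hop o ∣ ≤ 1
∣hop∣≤1 {d} nothing  = ≤-trans (≤-reflexive (∣∅∣ {d})) z≤n
∣hop∣≤1     (just i) = ≤-reflexive (∣⁅i⁆∣ i)

-- Toggle a light coordinate i.  If no cop is stuck the robber stops there; otherwise the budgets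
-- add up to ∑∣blocked∣ + #stuck ≤ 2k + 1, so at most 2k + 1 < d coordinates are forbidden for the
-- second toggle.
escape : 2 + 2 * k ≤ d → (s : Fin k → Cube d) → (∀ c → 1 ≤ ∣ s c ∣) →
         ∃₂ λ (o₁ o₂ : Maybe (Fin d)) → ∀ c → 3 ≤ ∣ hop o₂ ⊕ hop o₁ ⊕ s c ∣
escape 2+2k≤d s nonzero with lightCoordinate 2+2k≤d s
... | i , light with 1 ≤? ∣ stuckCops s i ∣
...   | no  none = just i , nothing , noneStuck⇒far s i (≤-pred (≰⇒> none))
...   | yes some with uncovered (forbidden s i) (someStuck⇒fewForbidden 2+2k≤d s nonzero light some)
...     | j , free = just i , just j , λ c →
  unblocked⇒far (s c) i (nonzero c) (≤-trans (fi≤∑f (λ c → load (s c) i) c) light) (free zero) (free (suc c))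

record CubeRetract (G : Graph) (d : ℕ) : Set where
  field
    embed         : Cube d → V G
    project       : V G → Cube d
    project-embed : ∀ x → project (embed x) ≗ x
    embed-adj     : ∀ x i → Adj G (embed x) (embed (⁅ i ⁆ ⊕ x))
    project-adj   : ∀ {u v} → Adj G u v → hamming (project u) (project v) ≤ 1

record EdgeRetract (G : Graph) : Set where
  field
    end      : Bool → V G
    side     : V G → Bool
    side-end : ∀ b → side (end b) ≡ b
    end-adj  : ∀ b → Adj G (end b) (end (not b))

module _ {G : Graph} (E : EdgeRetract G) where
  open EdgeRetract E

  edge⇒cubeRetract : CubeRetract G 1
  edge⇒cubeRetract = record
    { embed         = λ x → end (x zero)
    ; project       = λ v _ → side v
    ; project-embed = λ { x zero → side-end (x zero) }
    ; embed-adj     = λ { x zero → end-adj (x zero) }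
    ; project-adj   = λ {u} {v} _ → ≤-trans (≤-reflexive (+-identityʳ _)) (bit≤1 (side u xor side v))
    }

  □-cubeRetract : ∀ {H d} → CubeRetract H d → CubeRetract (G □ H) (suc d)
  □-cubeRetract {H} {d} R = record
    { embed         = λ x → end (x zero) , R.embed (x ∘ suc)
    ; project       = project
    ; project-embed = λ { x zero → side-end (x zero) ; x (suc j) → R.project-embed (x ∘ suc) j }
    ; embed-adj     = λ { x zero → inj₁ (end-adj (x zero) , refl) ; x (suc i) → inj₂ (refl , R.embed-adj (x ∘ suc) i) }
    ; project-adj   = project-adj
    }
    where
    module R = CubeRetract R

    project : V (G □ H) → Cube (suc d)
    project (g , h) = side g ∷ R.project h

    project-adj : ∀ {u v} → Adj (G □ H) u v → hamming (project u) (project v) ≤ 1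
    project-adj {g , h} {g′ , .h} (inj₁ (_ , refl)) rewrite hamming-≗ {p = R.project h} (λ _ → refl) =
      ≤-trans (≤-reflexive (+-identityʳ _)) (bit≤1 (side g xor side g′))
    project-adj {g , _} {.g , _} (inj₂ (refl , h~h′)) rewrite xor-same (side g) = R.project-adj h~h′

prod-cubeRetract : ∀ m (T : Fin (suc m) → Graph) → (∀ i → EdgeRetract (T i)) → CubeRetract (prod m T) (suc m)
prod-cubeRetract zero    T E = edge⇒cubeRetract (E zero)
prod-cubeRetract (suc m) T E = □-cubeRetract (E zero) (prod-cubeRetract m (T ∘ suc) (E ∘ suc))

walk⇒edge : ∀ {G : Graph} {u v} → DecidableEquality (V G) → Walk G u v → u ≢ v →
            ∃₂ λ a b → Adj G a b × a ≢ b
walk⇒edge _≟_ here u≢u = contradiction refl u≢u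
walk⇒edge _≟_ (step {u} {w} u~w w⇝v) u≢v with u ≟ w
... | yes refl = walk⇒edge _≟_ w⇝v u≢v
... | no u≢w   = u , w , u~w , u≢w

edgeRetract : ∀ {G : Graph} → DecidableEquality (V G) → Connected G → Nontrivial G → EdgeRetract G
edgeRetract {G} _≟_ connected (u , v , u≢v) with walk⇒edge _≟_ (connected u v) u≢v
... | a , b , a~b , a≢b = record
  { end      = λ { false → a ; true → b }
  ; side     = λ x → does (x ≟ b)
  ; side-end = λ { false → dec-false (a ≟ b) a≢b ; true → dec-true (b ≟ b) refl }
  ; end-adj  = λ { false → a~b ; true → Graph.sym G a~b }
  }

finite⇒decEq : ∀ {G : Graph} → IsFinite G → DecidableEquality (V G)
finite⇒decEq ((_ , V↔Fin) , _) = via-injection (Inverse⇒Injection V↔Fin) _≟ᶠ_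

tree⇒edgeRetract : ∀ {T : Graph} → IsTree T → Nontrivial T → EdgeRetract T
tree⇒edgeRetract {T} (finite , connected , _) = edgeRetract (finite⇒decEq {T} finite) connected

module RobberEvades {G : Graph} {d : ℕ} (R : CubeRetract G d) {k : ℕ} (2+2k≤d : 2 + 2 * k ≤ d) where
  open CubeRetract R
  open Game G k

  Far : ℕ → Config → Cube d → Set
  Far r C x = ∀ c → r ≤ hamming (project (C c)) x

  far⇒unoccupied : ∀ {C x} → Far 1 C x → ¬ Occupied C (embed x)
  far⇒unoccupied {C} {x} far (c , Cc≡x) = <⇒≢ (far c) (sym (begin
    hamming (project (C c)) x      ≡⟨ cong (λ v → hamming (project v) x) Cc≡x ⟩
    hamming (project (embed x)) x  ≡⟨ hamming-≗ (project-embed x) ⟩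
    0                              ∎))
    where open ≡-Reasoning

  far3⇒far1 : ∀ {C x} → Far 3 C x → Far 1 C x
  far3⇒far1 far c = ≤-trans (s≤s z≤n) (far c)

  reach2⇒hamming≤2 : ∀ {u v} → Reach2 u v → hamming (project u) (project v) ≤ 2
  reach2⇒hamming≤2 {u} {v} (w , u~w , w~v) =
    ≤-trans (hamming-triangle (project u) (project w) (project v)) (+-mono-≤ (project-adj u~w) (project-adj w~v))

  copMove⇒far1 : ∀ {C C′ x} → CopMove C C′ → Far 3 C x → Far 1 C′ x
  copMove⇒far1 {C} {C′} {x} moved far c = +-cancelˡ-≤ 2 1 _ (begin
    3                                                                      ≤⟨ far c ⟩
    hamming (project (C c)) x                                              ≤⟨ hamming-triangle (project (C c)) (project (C′ c)) x ⟩
    hamming (project (C c)) (project (C′ c)) + hamming (project (C′ c)) x  ≤⟨ +-monoˡ-≤ _ (reach2⇒hamming≤2 (moved c)) ⟩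
    2 + hamming (project (C′ c)) x                                         ∎)
    where open ≤-Reasoning

  embed-hop : ∀ x o → Adj G (embed x) (embed (hop o ⊕ x))
  embed-hop x nothing  = Graph.refl G (embed x)
  embed-hop x (just i) = embed-adj x i

  robberMove : ∀ {C x} → Far 1 C x → ∃ λ y → RobMove C (embed x) (embed y) × Far 3 C y
  robberMove {C} {x} far with escape 2+2k≤d (λ c → project (C c) ⊕ x) far
  ... | o₁ , o₂ , far3 =
    y , (embed z , embed-hop x o₁ , embed-hop z o₂ , far⇒unoccupied far-z , far⇒unoccupied (far3⇒far1 far-y)) , far-y
    where
    z y : Cube d
    z = hop o₁ ⊕ x
    y = hop o₂ ⊕ z

    far-y : Far 3 C y
    far-y c = ≤-trans (far3 c) (≤-reflexive (sym (sum-cong-≗ λ j → cong bit (begin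
      p j xor (hop o₂ j xor (hop o₁ j xor x j))  ≡⟨ xor-leftComm (p j) (hop o₂ j) _ ⟩
      hop o₂ j xor (p j xor (hop o₁ j xor x j))  ≡⟨ cong (hop o₂ j xor_) (xor-leftComm (p j) (hop o₁ j) (x j)) ⟩
      hop o₂ j xor (hop o₁ j xor (p j xor x j))  ∎))))
      where
      open ≡-Reasoning
      p : Cube d
      p = project (C c)

    far-z : Far 1 C z
    far-z c = +-cancelʳ-≤ 1 1 _ (begin
      2                                        ≤⟨ s≤s (s≤s z≤n) ⟩
      3                                        ≤⟨ far-y c ⟩
      hamming (project (C c)) y                ≤⟨ hamming-triangle (project (C c)) z y ⟩
      hamming (project (C c)) z + hamming z y  ≤⟨ +-monoʳ-≤ _ (≤-trans (≤-reflexive (hamming-⊕ˡ z (hop o₂))) (∣hop∣≤1 o₂)) ⟩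
      hamming (project (C c)) z + 1            ∎)
      where open ≤-Reasoning

  evade : ∀ {C x} → Far 3 C x → ¬ CopsForce C (embed x)
  evade far (move C′ moved (inj₁ caught)) = far⇒unoccupied (copMove⇒far1 moved far) caught
  evade far (move C′ moved (inj₂ next)) =
    let y , ran , far′ = robberMove (copMove⇒far1 moved far) in evade far′ (next (embed y) ran)

  k≤d : k ≤ d
  k≤d = ≤-trans (m≤m+n k (k + 0)) (≤-trans (m≤n+m _ 2) 2+2k≤d)

  start : (C : Config) → ∃ λ x → Far 3 C x
  start C =
    let x₀ , far₀    = diagonal k≤d (λ c → project (C c))
        y  , _ , far = robberMove far₀
    in y , far

  copsLose : ¬ CopsWin
  copsLose (C₀ , win) =
    let x , far = start C₀ in [ far⇒unoccupied (far3⇒far1 far) , evade far ]′ (win (embed x))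

<n/2⇒2+2k≤n : ∀ {k} n → k < n / 2 → 2 + 2 * k ≤ n
<n/2⇒2+2k≤n {k} n k<n/2 = begin
  2 + 2 * k  ≡⟨ cong (2 +_) (*-comm 2 k) ⟩
  suc k * 2  ≤⟨ *-monoˡ-≤ 2 k<n/2 ⟩
  n / 2 * 2  ≤⟨ m/n*n≤m n 2 ⟩
  n          ∎
  where open ≤-Reasoning

theorem3p11 : (m : ℕ) (T : Fin (suc m) → Graph) →
    (∀ i → IsTree (T i)) → (∀ i → Nontrivial (T i)) →
    c22≥ (prod m T) (suc m / 2)
theorem3p11 m T trees nontrivial k copsWin = ≮⇒≥ λ k<d/2 →
  RobberEvades.copsLose R (<n/2⇒2+2k≤n (suc m) k<d/2) copsWin
  where
  R : CubeRetract (prod m T) (suc m)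
  R = prod-cubeRetract m T (λ i → tree⇒edgeRetract (trees i) (nontrivial i))
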